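{- Let $s$ be a composition and $w,w'$ Stirling $s$-permutations. Then $w'$ covers $w$ in the $s$-weak order if and only if $w'$ is the transposition of $w$ along an ascent.
   Context: $s=(s_1,\dots,s_n)$ is a composition (positive integers). A Stirling $s$-permutation is a word in which each $i\in[n]$ occurs $s_i$ times and which avoids the pattern $121$ (no $i<j$ with an occurrence of $j$ between two occurrences of $i$). The $a$-block $B_a$ of $w$ is the shortest consecutive substring containing all occurrences of $a$. For $1\le a<c\le n$, $(a,c)$ is an ascent of $w$ if $ac$ is a consecutive substring of $w$, equivalently $w=u_1B_acu_2$; the transposition of $w$ along $(a,c)$ is $u_1cB_au_2$. For $a<c$, $\#_w(c,a)$ is the number of occurrences of $c$ preceding the $a$-block. The $s$-weak order is defined by $w\le w'$ iff $\#_w(c,a)\le\#_{w'}(c,a)$ for all $1\le a<c\le n$ (inclusion of inversion multisets). -}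

module Defs where

open import Data.Nat using (ℕ; zero; suc; _+_; _≤_)
open import Data.Fin using (Fin; _<_; _≟_)
open import Data.List using (List; []; _∷_; _++_; length; filter)
open import Data.List.Membership.Propositional using (_∈_)
open import Data.Product using (Σ; ∃; _×_; _,_)
open import Data.Sum using (_⊎_)
open import Relation.Binary.PropositionalEquality using (_≡_)
open import Relation.Nullary using (¬_; yes; no)

-- A composition of length n: s i ≥ 1 for each letter i ∈ Fin n
-- (letters 1..n of the paper are represented as Fin n = {0..n-1}).
IsComposition : (n : ℕ) → (Fin n → ℕ) → Set
IsComposition n s = (i : Fin n) → 1 ≤ s i

Word : ℕ → Set
Word n = List (Fin n)

occ : {n : ℕ} → Fin n → Word n → ℕ
occ i w = length (filter (λ x → x ≟ i) w)

Contains121 : {n : ℕ} → Word n → Set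
Contains121 {n} w = Σ (Fin n) λ i → Σ (Fin n) λ j → i < j ×
  Σ (Word n) λ u₁ → Σ (Word n) λ u₂ → Σ (Word n) λ u₃ → Σ (Word n) λ u₄ →
    w ≡ u₁ ++ i ∷ u₂ ++ j ∷ u₃ ++ i ∷ u₄

IsStirling : {n : ℕ} → (Fin n → ℕ) → Word n → Set
IsStirling {n} s w = ((i : Fin n) → occ i w ≡ s i) × ¬ Contains121 w

-- w = u₁ ++ B ++ u₂ where B is the a-block of w: B begins and ends with a and
-- all occurrences of a lie in B (this is exactly the shortest consecutive
-- substring containing all occurrences of a, when a occurs in w).
IsBlockSplit : {n : ℕ} → Fin n → Word n → Word n → Word n → Word n → Set
IsBlockSplit a w u₁ B u₂ =
  w ≡ u₁ ++ B ++ u₂ × ¬ (a ∈ u₁) × ¬ (a ∈ u₂) ×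
  Σ (Word _) λ B' → (B ≡ a ∷ B') × (B' ≡ [] ⊎ Σ (Word _) λ B'' → B' ≡ B'' ++ a ∷ [])

IsAscent : {n : ℕ} → Word n → Fin n → Fin n → Set
IsAscent {n} w a c = a < c × Σ (Word n) λ u → Σ (Word n) λ v → w ≡ u ++ a ∷ c ∷ v

IsTransposition : {n : ℕ} → Word n → Fin n → Fin n → Word n → Set
IsTransposition {n} w a c w' =
  Σ (Word n) λ u₁ → Σ (Word n) λ B → Σ (Word n) λ u₂ →
    IsBlockSplit a w u₁ B (c ∷ u₂) × w' ≡ u₁ ++ c ∷ B ++ u₂

-- #_w(c,a): number of occurrences of c preceding the a-block
-- (i.e. preceding the first occurrence of a)
inv : {n : ℕ} → Word n → Fin n → Fin n → ℕ
inv [] c a = 0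
inv (x ∷ xs) c a with x ≟ a
... | yes _ = 0
... | no _ with x ≟ c
...   | yes _ = suc (inv xs c a)
...   | no _ = inv xs c a

_≼_ : {n : ℕ} → Word n → Word n → Set
_≼_ {n} w w' = (a c : Fin n) → a < c → inv w c a ≤ inv w' c a

Covers : {n : ℕ} → (Fin n → ℕ) → Word n → Word n → Set
Covers {n} s w w' =
  (w ≼ w') × ¬ (w ≡ w') ×
  ((z : Word n) → IsStirling s z → w ≼ z → z ≼ w' → ¬ (z ≡ w) → z ≡ w')

-- The s-weak order compares inversion counts, and a Stirling permutation is determined by its
-- letter counts and its inversions, so ≼ is antisymmetric on Stirling s-permutations.  The key
-- lemma: if w ≼ z and w ≢ z, some ascent (a , c) of w has strictly more inversions in z.  It is
-- proved by induction on the length, deleting the run formed by the least letter m in both words: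
-- an increasing ascent of the shortened words survives in w, or else (m , c) is one.
-- Transposing w along an ascent (a , c) adds one inversion (c , x) for each letter x of the a-block
-- and changes nothing else, and every z ≽ w gaining an inversion at (c , a) lies above the
-- transposition.  Hence the transposition covers w, and a cover of w equals the transposition along
-- the ascent produced by the key lemma.

module Submission where

open import Defs
open import Data.Nat as ℕ using (ℕ; zero; suc; _+_; z≤n; s≤s)
import Data.Nat.Properties as ℕₚ
open import Data.Fin using (Fin; _≟_; _<_; _≤_)
import Data.Fin.Properties as Finₚ
open import Data.List using (List; []; _∷_; _++_; [_]; length; filter; replicate)
open import Data.List.Properties using (++-assoc; ++-identityʳ; ∷-injective; ≡-dec; length-++; filter-++)
open import Data.List.Membership.Propositional using (_∈_; _∉_)
open import Data.List.Membership.Propositional.Properties using (∈-++⁺ˡ; ∈-++⁺ʳ; ∈-++⁻; ∈-∃++)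
open import Data.List.Relation.Unary.Any using (here; there; any?)
open import Data.List.Relation.Unary.All using (lookup)
import Data.List.Extrema as Extrema
open import Data.Nat.Induction using (<-wellFounded)
import Induction.WellFounded as WF
import Relation.Binary.Construct.On as On
open import Data.List.Relation.Binary.Permutation.Propositional using (_↭_; ↭-sym)
open import Data.List.Relation.Binary.Permutation.Propositional.Properties
  using (∈-resp-↭; ↭-length; filter-↭; shifts; ∷↭∷ʳ; ++⁺ˡ)
open import Data.Product using (Σ; Σ-syntax; ∃; ∃₂; _×_; _,_; proj₁; proj₂)
open import Data.Sum using (_⊎_; inj₁; inj₂; [_,_]′)
open import Function.Base using (_∘_; id)
open import Function.Bundles using (_⇔_; mk⇔)
open import Relation.Binary.Definitions using (tri<; tri≈; tri>)
open import Relation.Binary.PropositionalEquality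
  using (_≡_; _≢_; refl; sym; trans; cong; cong₂; subst; subst₂; module ≡-Reasoning)
open import Relation.Nullary using (¬_; Dec; yes; no; contradiction)

private variable
  n : ℕ

module _ {A : Set} where

  ++-≡-++⁻ : (p q p′ q′ : List A) → p ++ q ≡ p′ ++ q′ →
             (∃ λ r → p′ ≡ p ++ r × q ≡ r ++ q′) ⊎ (∃ λ r → p ≡ p′ ++ r × q′ ≡ r ++ q)
  ++-≡-++⁻ []      q p′       q′ eq = inj₁ (p′ , refl , eq)
  ++-≡-++⁻ (x ∷ p) q []       q′ eq = inj₂ (x ∷ p , refl , sym eq)
  ++-≡-++⁻ (x ∷ p) q (y ∷ p′) q′ eq with refl , eq′ ← ∷-injective eq
    with ++-≡-++⁻ p q p′ q′ eq′
  ... | inj₁ (r , e , e′) = inj₁ (r , cong (x ∷_) e , e′)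
  ... | inj₂ (r , e , e′) = inj₂ (r , cong (x ∷_) e , e′)

  ++∷-≡-++⁻ : ∀ (u : List A) {j} v p q → u ++ j ∷ v ≡ p ++ q →
              (∃ λ r → p ≡ u ++ j ∷ r × v ≡ r ++ q) ⊎ (∃ λ r → q ≡ r ++ j ∷ v × u ≡ p ++ r)
  ++∷-≡-++⁻ u      v []      q eq = inj₂ (u , sym eq , refl)
  ++∷-≡-++⁻ []     v (x ∷ p) q eq with refl , eq′ ← ∷-injective eq = inj₁ (p , refl , eq′)
  ++∷-≡-++⁻ (y ∷ u) v (x ∷ p) q eq with refl , eq′ ← ∷-injective eq
    with ++∷-≡-++⁻ u v p q eq′
  ... | inj₁ (r , e , e′) = inj₁ (r , cong (x ∷_) e , e′)
  ... | inj₂ (r , e , e′) = inj₂ (r , e , cong (x ∷_) e′)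

  ++∷∷-≡-++⁻ : ∀ {a c : A} (p q u v : List A) → p ++ q ≡ u ++ a ∷ c ∷ v →
               (∀ X → ∃₂ λ u′ v′ → p ++ X ++ q ≡ u′ ++ a ∷ c ∷ v′) ⊎
               (p ≡ u ++ [ a ] × q ≡ c ∷ v)
  ++∷∷-≡-++⁻ []          q u v eq = inj₁ λ X → X ++ u , v , trans (cong (X ++_) eq) (sym (++-assoc X u _))
  ++∷∷-≡-++⁻ (x ∷ [])    q [] v eq with refl , eq′ ← ∷-injective eq = inj₂ (refl , eq′)
  ++∷∷-≡-++⁻ (x ∷ y ∷ p) q [] v eq with refl , eq′ ← ∷-injective eq
    with refl , _ ← ∷-injective eq′ = inj₁ λ X → [] , p ++ X ++ q , refl
  ++∷∷-≡-++⁻ (x ∷ p)     q (y ∷ u) v eq with refl , eq′ ← ∷-injective eq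
    with ++∷∷-≡-++⁻ p q u v eq′
  ... | inj₁ f = inj₁ λ X → let u′ , v′ , e = f X in x ∷ u′ , v′ , cong (x ∷_) e
  ... | inj₂ (e , e′) = inj₂ (cong (x ∷_) e , e′)

  ∷-positions : ∀ {x y : A} (p s u r : List A) → p ++ x ∷ s ≡ u ++ y ∷ r → x ≢ y →
                (x ∈ u × y ∈ s) ⊎ (y ∈ p × x ∈ r)
  ∷-positions []      s []      r refl x≢y = contradiction refl x≢y
  ∷-positions []      s (_ ∷ u) r refl _   = inj₁ (here refl , ∈-++⁺ʳ u (here refl))
  ∷-positions (_ ∷ p) s []      r refl _   = inj₂ (here refl , ∈-++⁺ʳ p (here refl))
  ∷-positions (_ ∷ p) s (_ ∷ u) r eq x≢y with refl , eq′ ← ∷-injective eq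
    with ∷-positions p s u r eq′ x≢y
  ... | inj₁ (x∈u , y∈s) = inj₁ (there x∈u , y∈s)
  ... | inj₂ (y∈p , x∈r) = inj₂ (there y∈p , x∈r)

  ∈-insert-++ : ∀ {x : A} p X {q} → x ∈ p ++ q → x ∈ p ++ X ++ q
  ∈-insert-++ p X {q} x∈ with ∈-++⁻ p x∈
  ... | inj₁ x∈p = ∈-++⁺ˡ x∈p
  ... | inj₂ x∈q = ∈-++⁺ʳ p (∈-++⁺ʳ X x∈q)

  ∈-++∷⁻ : ∀ {x y : A} p {q} → x ∈ p ++ y ∷ q → x ≢ y → x ∈ p ++ q
  ∈-++∷⁻ p x∈ x≢y with ∈-++⁻ p x∈
  ... | inj₁ x∈p         = ∈-++⁺ˡ x∈p
  ... | inj₂ (here x≡y)  = contradiction x≡y x≢y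
  ... | inj₂ (there x∈q) = ∈-++⁺ʳ p x∈q

  length-insert-++ : ∀ (p X q : List A) → length (p ++ X ++ q) ≡ length X + length (p ++ q)
  length-insert-++ []      X q = length-++ X
  length-insert-++ (_ ∷ p) X q = trans (cong suc (length-insert-++ p X q)) (sym (ℕₚ.+-suc _ _))

  replicate-suc-++ : ∀ k (m : A) v → replicate (suc k) m ++ v ≡ replicate k m ++ m ∷ v
  replicate-suc-++ zero    m v = refl
  replicate-suc-++ (suc k) m v = cong (m ∷_) (replicate-suc-++ k m v)

  ∉-replicate : ∀ {x m : A} k → x ≢ m → x ∉ replicate k m
  ∉-replicate (suc k) x≢m (here x≡m) = x≢m x≡m
  ∉-replicate (suc k) x≢m (there x∈) = ∉-replicate k x≢m x∈

_∈?_ : (x : Fin n) (w : Word n) → Dec (x ∈ w)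
x ∈? w = any? (x ≟_) w

first-occurrence : {x : Fin n} {w : Word n} → x ∈ w → ∃₂ λ u v → w ≡ u ++ x ∷ v × x ∉ u
first-occurrence {x = x} {y ∷ w} x∈ with y ≟ x | x∈
... | yes refl | _ = [] , w , refl , λ ()
... | no y≢x | here x≡y = contradiction (sym x≡y) y≢x
... | no y≢x | there x∈w with u , v , refl , x∉u ← first-occurrence x∈w =
  y ∷ u , v , refl , λ { (here x≡y) → y≢x (sym x≡y) ; (there x∈u) → x∉u x∈u }

SameContent : Word n → Word n → Set
SameContent {n} w z = (i : Fin n) → occ i w ≡ occ i z

occ-∷-≡ : (i : Fin n) (w : Word n) → occ i (i ∷ w) ≡ suc (occ i w)
occ-∷-≡ i w with i ≟ i
... | yes _   = refl
... | no i≢i = contradiction refl i≢i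

occ-∷-≢ : {i x : Fin n} (w : Word n) → x ≢ i → occ i (x ∷ w) ≡ occ i w
occ-∷-≢ {i = i} {x} w x≢i with x ≟ i
... | yes x≡i = contradiction x≡i x≢i
... | no _    = refl

occ-++ : (i : Fin n) (u v : Word n) → occ i (u ++ v) ≡ occ i u + occ i v
occ-++ i u v = trans (cong length (filter-++ (_≟ i) u v)) (length-++ (filter (_≟ i) u))

occ-↭ : (i : Fin n) {u v : Word n} → u ↭ v → occ i u ≡ occ i v
occ-↭ i = ↭-length ∘ filter-↭ (_≟ i)

occ-∉ : {i : Fin n} (w : Word n) → i ∉ w → occ i w ≡ 0
occ-∉ []      _   = refl
occ-∉ (x ∷ w) i∉ = trans (occ-∷-≢ w (λ x≡i → i∉ (here (sym x≡i)))) (occ-∉ w (i∉ ∘ there))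

∈⇒0<occ : {i : Fin n} {w : Word n} → i ∈ w → 0 ℕ.< occ i w
∈⇒0<occ {i = i} i∈ with u , v , refl ← ∈-∃++ i∈ =
  subst (0 ℕ.<_) (sym (trans (occ-++ i u (i ∷ v)) (trans (cong (occ i u +_) (occ-∷-≡ i v)) (ℕₚ.+-suc _ _))))
    (s≤s z≤n)

occ-insert-++ : {i : Fin n} (p X q : Word n) → i ∉ X → occ i (p ++ X ++ q) ≡ occ i (p ++ q)
occ-insert-++ {i = i} p X q i∉X = begin
  occ i (p ++ X ++ q)           ≡⟨ occ-++ i p (X ++ q) ⟩
  occ i p + occ i (X ++ q)      ≡⟨ cong (occ i p +_) (occ-++ i X q) ⟩
  occ i p + (occ i X + occ i q) ≡⟨ cong (λ k → occ i p + (k + occ i q)) (occ-∉ X i∉X) ⟩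
  occ i p + occ i q             ≡⟨ occ-++ i p q ⟨
  occ i (p ++ q)                ∎
  where open ≡-Reasoning

occ-replicate : ∀ k (m : Fin n) → occ m (replicate k m) ≡ k
occ-replicate zero    m = refl
occ-replicate (suc k) m = trans (occ-∷-≡ m (replicate k m)) (cong suc (occ-replicate k m))

occ-run : ∀ {m : Fin n} {p q : Word n} k → m ∉ p → m ∉ q → occ m (p ++ replicate k m ++ q) ≡ k
occ-run {m = m} {p} {q} k m∉p m∉q = begin
  occ m (p ++ replicate k m ++ q)                   ≡⟨ occ-++ m p _ ⟩
  occ m p + occ m (replicate k m ++ q)              ≡⟨ cong (occ m p +_) (occ-++ m (replicate k m) q) ⟩
  occ m p + (occ m (replicate k m) + occ m q)       ≡⟨ cong₂ (λ x y → x + (occ m (replicate k m) + y))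
                                                             (occ-∉ p m∉p) (occ-∉ q m∉q) ⟩
  occ m (replicate k m) + 0                         ≡⟨ ℕₚ.+-identityʳ _ ⟩
  occ m (replicate k m)                             ≡⟨ occ-replicate k m ⟩
  k                                                 ∎
  where open ≡-Reasoning

0<occ⇒∈ : {i : Fin n} {w : Word n} → 0 ℕ.< occ i w → i ∈ w
0<occ⇒∈ {i = i} {w} 0<occ with i ∈? w
... | yes i∈w = i∈w
... | no  i∉w = contradiction (occ-∉ w i∉w) (ℕₚ.>⇒≢ 0<occ)

occ-<-++∷ : (i : Fin n) (p r : Word n) → occ i p ℕ.< occ i (p ++ i ∷ r)
occ-<-++∷ i p r = subst (occ i p ℕ.<_) (sym (trans (occ-++ i p (i ∷ r)) (cong (occ i p +_) (occ-∷-≡ i r))))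
  (ℕₚ.m<m+n (occ i p) (s≤s z≤n))

same-counts : {s : Fin n → ℕ} (w z : Word n) → (∀ i → occ i w ≡ s i) → (∀ i → occ i z ≡ s i) →
              SameContent w z
same-counts _ _ w-count z-count i = trans (w-count i) (sym (z-count i))

∈-resp-SameContent : {i : Fin n} {w z : Word n} → SameContent w z → i ∈ w → i ∈ z
∈-resp-SameContent {i = i} w≈z i∈w = 0<occ⇒∈ (subst (0 ℕ.<_) (w≈z i) (∈⇒0<occ i∈w))

SameContent-[] : {z : Word n} → SameContent [] z → z ≡ []
SameContent-[] {z = []}    _    = refl
SameContent-[] {z = x ∷ z} []≈z with () ← trans ([]≈z x) (occ-∷-≡ x z)

inv-∷-≡ : (a c : Fin n) (w : Word n) → inv (a ∷ w) c a ≡ 0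
inv-∷-≡ a c w with a ≟ a
... | yes _   = refl
... | no a≢a = contradiction refl a≢a

inv-∷-c : {a c : Fin n} (w : Word n) → c ≢ a → inv (c ∷ w) c a ≡ suc (inv w c a)
inv-∷-c {a = a} {c} w c≢a with c ≟ a
... | yes c≡a = contradiction c≡a c≢a
... | no _ with c ≟ c
...   | yes _   = refl
...   | no c≢c = contradiction refl c≢c

inv-∷-≢ : {a c x : Fin n} (w : Word n) → x ≢ a → x ≢ c → inv (x ∷ w) c a ≡ inv w c a
inv-∷-≢ {a = a} {c} {x} w x≢a x≢c with x ≟ a
... | yes x≡a = contradiction x≡a x≢a
... | no _ with x ≟ c
...   | yes x≡c = contradiction x≡c x≢c
...   | no _    = refl

inv-++-∉ : {a c : Fin n} (u v : Word n) → a ∉ u → inv (u ++ v) c a ≡ occ c u + inv v c a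
inv-++-∉ []      v _   = refl
inv-++-∉ {a = a} {c} (x ∷ u) v a∉ with x ≟ a
... | yes x≡a = contradiction (here (sym x≡a)) a∉
... | no _ with x ≟ c
...   | yes _ = cong suc (inv-++-∉ u v (a∉ ∘ there))
...   | no _  = inv-++-∉ u v (a∉ ∘ there)

inv-++-∈ : {a c : Fin n} (u v : Word n) → a ∈ u → inv (u ++ v) c a ≡ inv u c a
inv-++-∈ {a = a} {c} (x ∷ u) v a∈ with x ≟ a | a∈
... | yes _   | _          = refl
... | no x≢a | here a≡x  = contradiction (sym a≡x) x≢a
... | no _   | there a∈u with x ≟ c
...   | yes _ = cong suc (inv-++-∈ u v a∈u)
...   | no _  = inv-++-∈ u v a∈u

inv-++-congʳ : {a c : Fin n} (u : Word n) {v v′ : Word n} →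
               inv v c a ≡ inv v′ c a → inv (u ++ v) c a ≡ inv (u ++ v′) c a
inv-++-congʳ []      eq = eq
inv-++-congʳ {a = a} {c} (x ∷ u) eq with x ≟ a
... | yes _ = refl
... | no _ with x ≟ c
...   | yes _ = cong suc (inv-++-congʳ u eq)
...   | no _  = inv-++-congʳ u eq

inv-≤-occ : (a c : Fin n) (w : Word n) → inv w c a ℕ.≤ occ c w
inv-≤-occ a c []      = z≤n
inv-≤-occ a c (x ∷ w) with x ≟ a
... | yes _ = z≤n
... | no _ with x ≟ c
...   | yes _ = s≤s (inv-≤-occ a c w)
...   | no _  = inv-≤-occ a c w

inv-∉ : {a c : Fin n} (w : Word n) → a ∉ w → inv w c a ≡ occ c w
inv-∉ {a = a} {c} w a∉w = begin
  inv w c a              ≡⟨ cong (λ u → inv u c a) (++-identityʳ w) ⟨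
  inv (w ++ []) c a      ≡⟨ inv-++-∉ w [] a∉w ⟩
  occ c w + 0            ≡⟨ ℕₚ.+-identityʳ _ ⟩
  occ c w                ∎
  where open ≡-Reasoning

inv-first : {a c : Fin n} (u v : Word n) → a ∉ u → inv (u ++ a ∷ v) c a ≡ occ c u
inv-first {a = a} {c} u v a∉u =
  trans (inv-++-∉ u (a ∷ v) a∉u) (trans (cong (occ c u +_) (inv-∷-≡ a c v)) (ℕₚ.+-identityʳ _))

inv-insert-++ : {a c : Fin n} (p X q : Word n) → a ∉ X → c ∉ X →
                inv (p ++ X ++ q) c a ≡ inv (p ++ q) c a
inv-insert-++ {c = c} p X q a∉X c∉X =
  inv-++-congʳ p (trans (inv-++-∉ X q a∉X) (cong (_+ _) (occ-∉ X c∉X)))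

inv-↭-prefix : {a c : Fin n} {u u′ : Word n} (v : Word n) → a ∉ u → u ↭ u′ →
               inv (u ++ v) c a ≡ inv (u′ ++ v) c a
inv-↭-prefix {a = a} {c} {u} {u′} v a∉u u↭u′ = begin
  inv (u ++ v) c a       ≡⟨ inv-++-∉ u v a∉u ⟩
  occ c u + inv v c a    ≡⟨ cong (_+ _) (occ-↭ c u↭u′) ⟩
  occ c u′ + inv v c a   ≡⟨ inv-++-∉ u′ v (a∉u ∘ ∈-resp-↭ (↭-sym u↭u′)) ⟨
  inv (u′ ++ v) c a      ∎
  where open ≡-Reasoning

inv-≤-of-preceding : {a x c : Fin n} (w : Word n) → 0 ℕ.< inv w a x →
                     a ≢ x → c ≢ x → c ≢ a → inv w c a ℕ.≤ inv w c x
inv-≤-of-preceding {a = a} {x} {c} (y ∷ w) a-before a≢x c≢x c≢a with y ≟ x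
... | yes refl = contradiction a-before (λ ())
... | no _ with y ≟ a
...   | yes refl = z≤n
...   | no _ with y ≟ c
...     | yes refl = s≤s (inv-≤-of-preceding w a-before a≢x c≢x c≢a)
...     | no _     = inv-≤-of-preceding w a-before a≢x c≢x c≢a

-- Equivalent to ¬ Contains121, but phrased at an occurrence of the middle letter j.
Avoids121 : Word n → Set
Avoids121 {n} w = ∀ {i j : Fin n} u v → w ≡ u ++ j ∷ v → i < j → i ∈ u → i ∉ v

¬Contains121⇒Avoids121 : {w : Word n} → ¬ Contains121 w → Avoids121 w
¬Contains121⇒Avoids121 ¬121 {i} {j} u v refl i<j i∈u i∈v
  with u₁ , u₂ , refl ← ∈-∃++ i∈u | v₁ , v₂ , refl ← ∈-∃++ i∈v =
  ¬121 (i , j , i<j , u₁ , u₂ , v₁ , v₂ , ++-assoc u₁ (i ∷ u₂) (j ∷ v₁ ++ i ∷ v₂))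

Avoids121⇒¬Contains121 : {w : Word n} → Avoids121 w → ¬ Contains121 w
Avoids121⇒¬Contains121 avoid (i , j , i<j , u₁ , u₂ , u₃ , u₄ , refl) =
  avoid (u₁ ++ i ∷ u₂) (u₃ ++ i ∷ u₄) (sym (++-assoc u₁ (i ∷ u₂) (j ∷ u₃ ++ i ∷ u₄))) i<j
    (∈-++⁺ʳ u₁ (here refl)) (∈-++⁺ʳ u₃ (here refl))

Avoids121-erase : (p X q : Word n) → Avoids121 (p ++ X ++ q) → Avoids121 (p ++ q)
Avoids121-erase p X q avoid {i} {j} u v eq i<j i∈u i∈v with ++∷-≡-++⁻ u v p q (sym eq)
... | inj₁ (r , refl , refl) =
  avoid u (r ++ X ++ q) (++-assoc u (j ∷ r) (X ++ q)) i<j i∈u (∈-insert-++ r X i∈v)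
... | inj₂ (r , refl , refl) =
  avoid (p ++ X ++ r) v (sym (trans (++-assoc p (X ++ r) (j ∷ v)) (cong (p ++_) (++-assoc X r (j ∷ v)))))
    i<j (∈-insert-++ p X i∈u) i∈v

Avoids121-tail : (x : Fin n) (w : Word n) → Avoids121 (x ∷ w) → Avoids121 w
Avoids121-tail x = Avoids121-erase [] [ x ]

Avoids121-between : {a c : Fin n} {w : Word n} (P Q R : Word n) → Avoids121 w →
                    w ≡ P ++ a ∷ Q ++ a ∷ R → a < c → c ∉ Q
Avoids121-between {a = a} {c} {w} P Q R avoid eq a<c c∈Q with Q₁ , Q₂ , refl ← ∈-∃++ c∈Q =
  avoid (P ++ a ∷ Q₁) (Q₂ ++ a ∷ R) eq′ a<c (∈-++⁺ʳ P (here refl)) (∈-++⁺ʳ Q₂ (here refl))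
  where
  eq′ : w ≡ (P ++ a ∷ Q₁) ++ c ∷ Q₂ ++ a ∷ R
  eq′ = trans eq (sym (trans (++-assoc P (a ∷ Q₁) (c ∷ Q₂ ++ a ∷ R))
                              (cong (λ T → P ++ a ∷ T) (sym (++-assoc Q₁ (c ∷ Q₂) (a ∷ R))))))

inv-tail≡0 : {x c : Fin n} (w : Word n) → Avoids121 (x ∷ w) → x < c → x ∈ w → inv w c x ≡ 0
inv-tail≡0 w avoid x<c x∈w with P , S , refl , x∉P ← first-occurrence x∈w =
  trans (inv-first P S x∉P) (occ-∉ P (Avoids121-between [] P S avoid refl x<c))

inversions-injective : (w z : Word n) → Avoids121 w → Avoids121 z → SameContent w z →
                       (∀ a c → a < c → inv w c a ≡ inv z c a) → w ≡ z
inversions-injective []      z       _ _ w≈z _ = sym (SameContent-[] w≈z)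
inversions-injective (x ∷ w) []      _ _ w≈z _ = SameContent-[] (sym ∘ w≈z)
inversions-injective (x ∷ w) (y ∷ z) aw az w≈z inv≡ with Finₚ.<-cmp x y
... | tri< x<y _ _
  with () ← trans (sym (inv-∷-≡ x y w)) (trans (inv≡ x y x<y) (inv-∷-c z (Finₚ.<⇒≢ x<y ∘ sym)))
... | tri> _ _ y<x
  with () ← trans (sym (inv-∷-c w (Finₚ.<⇒≢ y<x ∘ sym))) (trans (inv≡ y x y<x) (inv-∷-≡ y x z))
... | tri≈ _ refl _ =
  cong (x ∷_) (inversions-injective w z (Avoids121-tail x w aw) (Avoids121-tail x z az) tail-content tail-inv)
  where
  tail-content : SameContent w z
  tail-content i with x ≟ i
  ... | yes refl = ℕₚ.suc-injective (trans (sym (occ-∷-≡ x w)) (trans (w≈z x) (occ-∷-≡ x z)))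
  ... | no x≢i  = trans (sym (occ-∷-≢ w x≢i)) (trans (w≈z i) (occ-∷-≢ z x≢i))

  tail-inv : ∀ a c → a < c → inv w c a ≡ inv z c a
  tail-inv a c a<c with x ≟ a | x ≟ c
  ... | yes refl | _ with x ∈? w
  ...   | yes x∈w = trans (inv-tail≡0 w aw a<c x∈w)
                      (sym (inv-tail≡0 z az a<c (∈-resp-SameContent tail-content x∈w)))
  ...   | no x∉w  = trans (inv-∉ w x∉w) (trans (tail-content c)
                      (sym (inv-∉ z (x∉w ∘ ∈-resp-SameContent (sym ∘ tail-content)))))
  tail-inv a c a<c | no x≢a | yes refl =
    ℕₚ.suc-injective (trans (sym (inv-∷-c w x≢a)) (trans (inv≡ a x a<c) (inv-∷-c z x≢a)))
  tail-inv a c a<c | no x≢a | no x≢c =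
    trans (sym (inv-∷-≢ w x≢a x≢c)) (trans (inv≡ a c a<c) (inv-∷-≢ z x≢a x≢c))

≼-antisym : {w z : Word n} → Avoids121 w → Avoids121 z → SameContent w z → w ≼ z → z ≼ w → w ≡ z
≼-antisym {w = w} {z} aw az w≈z w≼z z≼w =
  inversions-injective w z aw az w≈z λ a c a<c → ℕₚ.≤-antisym (w≼z a c a<c) (z≼w a c a<c)

inv-at-occurrence : {a c : Fin n} {w : Word n} (u v : Word n) → Avoids121 w →
                    w ≡ u ++ a ∷ v → a < c → inv w c a ≡ occ c u
inv-at-occurrence {a = a} {c} u v avoid refl a<c with a ∈? u
... | no a∉u = inv-first u v a∉u
... | yes a∈u with P , Q , refl , a∉P ← first-occurrence a∈u = begin
  inv ((P ++ a ∷ Q) ++ a ∷ v) c a  ≡⟨ cong (λ T → inv T c a) (++-assoc P (a ∷ Q) (a ∷ v)) ⟩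
  inv (P ++ a ∷ Q ++ a ∷ v) c a    ≡⟨ inv-first P (Q ++ a ∷ v) a∉P ⟩
  occ c P                           ≡⟨ ℕₚ.+-identityʳ _ ⟨
  occ c P + 0                       ≡⟨ cong (occ c P +_) (occ-∉ (a ∷ Q) c∉aQ) ⟨
  occ c P + occ c (a ∷ Q)           ≡⟨ occ-++ c P (a ∷ Q) ⟨
  occ c (P ++ a ∷ Q)                ∎
  where
  open ≡-Reasoning
  c∉aQ : c ∉ a ∷ Q
  c∉aQ (here c≡a) = Finₚ.<⇒≢ a<c (sym c≡a)
  c∉aQ (there c∈Q) = Avoids121-between P Q v avoid (++-assoc P (a ∷ Q) (a ∷ v)) a<c c∈Q

IncreasingAscent : Word n → Word n → Set
IncreasingAscent {n} w z = Σ[ a ∈ Fin n ] Σ[ c ∈ Fin n ] IsAscent w a c × inv w c a ℕ.< inv z c a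

minimum-letter : (w : Word n) → w ≢ [] → Σ[ m ∈ Fin n ] m ∈ w × (∀ {y} → y ∈ w → m ≤ y)
minimum-letter []      []≢[] = contradiction refl []≢[]
minimum-letter {n} (x ∷ w) _ =
  min x w , [ here , there ]′ (argmin-sel id x w) , min≤
  where
  open Extrema (Finₚ.≤-totalOrder n)
  min≤ : ∀ {y} → y ∈ x ∷ w → min x w ≤ y
  min≤ (here refl)  = min≤⊤ x w
  min≤ (there y∈w) = lookup (min≤xs x w) y∈w

leading-run : (m : Fin n) (r : Word n) →
              ∃₂ λ k q → r ≡ replicate k m ++ q × (∀ {y q′} → q ≡ y ∷ q′ → y ≢ m)
leading-run m []      = 0 , [] , refl , λ ()
leading-run m (y ∷ r) with y ≟ m
... | yes refl = let k , q , eq , q-head = leading-run m r in suc k , q , cong (m ∷_) eq , q-head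
... | no y≢m  = 0 , y ∷ r , refl , λ { refl → y≢m }

minimum-run : {m : Fin n} {w : Word n} → Avoids121 w → m ∈ w → (∀ {y} → y ∈ w → m ≤ y) →
              ∃ λ p → ∃₂ λ k q → w ≡ p ++ replicate (suc k) m ++ q × m ∉ p × m ∉ q
minimum-run {m = m} avoid m∈w minimal
  with p , r , refl , m∉p ← first-occurrence m∈w
  with k , q , refl , q-head ← leading-run m r =
  p , k , q , refl , m∉p , m∉q
  where
  m∉q : m ∉ q
  m∉q m∈q with ∈-∃++ m∈q
  ... | []     , q₂ , refl = q-head refl refl
  ... | y ∷ q₁ , q₂ , refl =
    avoid (p ++ m ∷ replicate k m) (q₁ ++ m ∷ q₂) (sym (++-assoc p (m ∷ replicate k m) (y ∷ q₁ ++ m ∷ q₂)))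
      (Finₚ.≤∧≢⇒< (minimal (∈-++⁺ʳ p (there (∈-++⁺ʳ (replicate k m) (here refl)))))
                   (q-head refl ∘ sym))
      (∈-++⁺ʳ p (here refl)) (∈-++⁺ʳ q₁ (here refl))

StrictlyBelow⇒IncreasingAscent : Word n → Set
StrictlyBelow⇒IncreasingAscent {n} w = {z : Word n} → Avoids121 w → Avoids121 z → SameContent w z →
                                     w ≼ z → w ≢ z → IncreasingAscent w z

module MinimalRun {n : ℕ} {m : Fin n} (k : ℕ) {p q p′ q′ : Word n}
  (m∉p : m ∉ p) (m∉q : m ∉ q) (m∉p′ : m ∉ p′) (m∉q′ : m ∉ q′)
  (minimal : ∀ {y} → y ∈ p ++ replicate (suc k) m ++ q → m ≤ y)
  (avoid : Avoids121 (p ++ replicate (suc k) m ++ q))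
  (avoid′ : Avoids121 (p′ ++ replicate (suc k) m ++ q′))
  (w≈z : SameContent (p ++ replicate (suc k) m ++ q) (p′ ++ replicate (suc k) m ++ q′))
  (w≼z : (p ++ replicate (suc k) m ++ q) ≼ (p′ ++ replicate (suc k) m ++ q′))
  where

  private
    M w z : Word n
    M = replicate (suc k) m
    w = p ++ M ++ q
    z = p′ ++ M ++ q′

  ∉M : ∀ {x} → x ≢ m → x ∉ M
  ∉M = ∉-replicate (suc k)

  m∉pq : m ∉ p ++ q
  m∉pq = [ m∉p , m∉q ]′ ∘ ∈-++⁻ p

  m∉p′q′ : m ∉ p′ ++ q′
  m∉p′q′ = [ m∉p′ , m∉q′ ]′ ∘ ∈-++⁻ p′

  minimum< : ∀ {c} → c ∈ w → c ≢ m → m < c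
  minimum< c∈w c≢m = Finₚ.≤∧≢⇒< (minimal c∈w) (c≢m ∘ sym)

  erased-content : SameContent (p ++ q) (p′ ++ q′)
  erased-content i with i ≟ m
  ... | yes refl = trans (occ-∉ (p ++ q) m∉pq) (sym (occ-∉ (p′ ++ q′) m∉p′q′))
  ... | no i≢m  = trans (sym (occ-insert-++ p M q (∉M i≢m))) (trans (w≈z i) (occ-insert-++ p′ M q′ (∉M i≢m)))

  erased-inv-absent : ∀ {a} c → a ∉ p ++ q → inv (p ++ q) c a ≡ inv (p′ ++ q′) c a
  erased-inv-absent c a∉ = trans (inv-∉ (p ++ q) a∉) (trans (erased-content c)
                             (sym (inv-∉ (p′ ++ q′) (a∉ ∘ ∈-resp-SameContent (sym ∘ erased-content)))))

  erased-≼ : (p ++ q) ≼ (p′ ++ q′)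
  erased-≼ a c a<c with a ≟ m | c ≟ m
  ... | yes refl | _       = ℕₚ.≤-reflexive (erased-inv-absent c m∉pq)
  ... | no _     | yes refl =
    ℕₚ.≤-reflexive (erased-inv-absent c (λ a∈ → ℕₚ.<⇒≱ a<c (minimal (∈-insert-++ p M a∈))))
  ... | no a≢m   | no c≢m  = subst₂ ℕ._≤_ (inv-insert-++ p M q (∉M a≢m) (∉M c≢m))
                                          (inv-insert-++ p′ M q′ (∉M a≢m) (∉M c≢m)) (w≼z a c a<c)

  inv-w-m : ∀ c → inv w c m ≡ occ c p
  inv-w-m c = inv-first p (replicate k m ++ q) m∉p

  inv-z-m : ∀ c → inv z c m ≡ occ c p′
  inv-z-m c = inv-first p′ (replicate k m ++ q′) m∉p′

  prefix-occ-≤ : ∀ {c} → m < c → occ c p ℕ.≤ occ c p′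
  prefix-occ-≤ {c} m<c = subst₂ ℕ._≤_ (inv-w-m c) (inv-z-m c) (w≼z m c m<c)

  ascent-from-minimum : ∀ {c} v → q ≡ c ∷ v → occ c p ℕ.< occ c p′ → IncreasingAscent w z
  ascent-from-minimum {c} v q≡ grows =
    m , c , (minimum< c∈w c≢m , p ++ replicate k m , v , w≡) ,
    subst₂ ℕ._<_ (sym (inv-w-m c)) (sym (inv-z-m c)) grows
    where
    c∈q : c ∈ q
    c∈q = subst (c ∈_) (sym q≡) (here refl)
    c∈w : c ∈ w
    c∈w = ∈-++⁺ʳ p (∈-++⁺ʳ M c∈q)
    c≢m : c ≢ m
    c≢m refl = m∉q c∈q
    w≡ : w ≡ (p ++ replicate k m) ++ m ∷ c ∷ v
    w≡ = trans (cong (λ T → p ++ M ++ T) q≡)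
           (trans (cong (p ++_) (replicate-suc-++ k m (c ∷ v))) (sym (++-assoc p (replicate k m) (m ∷ c ∷ v))))

  lift : IncreasingAscent (p ++ q) (p′ ++ q′) → IncreasingAscent w z
  lift (a , c , (a<c , u , v , eq) , grows) with ++∷∷-≡-++⁻ p q u v eq
  ... | inj₁ insert = let u′ , v′ , eq′ = insert M in a , c , (a<c , u′ , v′ , eq′) , grows′
    where
    ≢m : ∀ {x} → x ∈ p ++ q → x ≢ m
    ≢m x∈ refl = m∉pq x∈
    a≢m : a ≢ m
    a≢m = ≢m (subst (a ∈_) (sym eq) (∈-++⁺ʳ u (here refl)))
    c≢m : c ≢ m
    c≢m = ≢m (subst (c ∈_) (sym eq) (∈-++⁺ʳ u (there (here refl))))
    grows′ : inv w c a ℕ.< inv z c a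
    grows′ = subst₂ ℕ._<_ (sym (inv-insert-++ p M q (∉M a≢m) (∉M c≢m)))
                          (sym (inv-insert-++ p′ M q′ (∉M a≢m) (∉M c≢m))) grows
  ... | inj₂ (p≡ , q≡) = ascent-from-minimum v q≡ (begin-strict
    occ c p                   ≡⟨ cong (occ c) p≡ ⟩
    occ c (u ++ [ a ])        ≡⟨ occ-insert-++ u [ a ] [] (λ { (here refl) → Finₚ.<-irrefl refl a<c }) ⟩
    occ c (u ++ [])           ≡⟨ cong (occ c) (++-identityʳ u) ⟩
    occ c u                   ≡⟨ inv-at-occurrence u (c ∷ v) (Avoids121-erase p M q avoid) eq a<c ⟨
    inv (p ++ q) c a          <⟨ grows ⟩
    inv (p′ ++ q′) c a        ≡⟨ inv-++-∈ p′ q′ a∈p′ ⟩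
    inv p′ c a                ≤⟨ inv-≤-occ a c p′ ⟩
    occ c p′                  ∎)
    where
    open ℕₚ.≤-Reasoning
    a∈p : a ∈ p
    a∈p = subst (a ∈_) (sym p≡) (∈-++⁺ʳ u (here refl))
    a∈p′ : a ∈ p′
    a∈p′ = 0<occ⇒∈ (ℕₚ.<-≤-trans (∈⇒0<occ a∈p)
             (prefix-occ-≤ (minimum< (∈-++⁺ˡ a∈p) (λ { refl → m∉p a∈p }))))

  same-erasure : p ++ q ≡ p′ ++ q′ → w ≢ z → IncreasingAscent w z
  same-erasure eq w≢z with ++-≡-++⁻ p q p′ q′ eq
  ... | inj₁ ([] , p′≡ , q≡) =
    contradiction (cong₂ (λ P Q → P ++ M ++ Q) (trans (sym (++-identityʳ p)) (sym p′≡)) q≡) w≢z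
  ... | inj₂ ([] , p≡ , q′≡) =
    contradiction (cong₂ (λ P Q → P ++ M ++ Q) (trans p≡ (++-identityʳ p′)) (sym q′≡)) w≢z
  ... | inj₁ (c ∷ r , p′≡ , q≡) =
    ascent-from-minimum (r ++ q′) q≡ (subst (occ c p ℕ.<_) (cong (occ c) (sym p′≡)) (occ-<-++∷ c p r))
  ... | inj₂ (y ∷ r , p≡ , _) =
    contradiction (prefix-occ-≤ (minimum< (∈-++⁺ˡ y∈p) (λ { refl → m∉p y∈p })))
                  (ℕₚ.<⇒≱ (subst (occ y p′ ℕ.<_) (cong (occ y) (sym p≡)) (occ-<-++∷ y p′ r)))
    where
    y∈p : y ∈ p
    y∈p = subst (y ∈_) (sym p≡) (∈-++⁺ʳ p′ (here refl))

  step : (∀ {w₀} → length w₀ ℕ.< length w → StrictlyBelow⇒IncreasingAscent w₀) →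
         w ≢ z → IncreasingAscent w z
  step ih w≢z with ≡-dec _≟_ (p ++ q) (p′ ++ q′)
  ... | yes eq = same-erasure eq w≢z
  ... | no ne  = lift (ih shorter (Avoids121-erase p M q avoid) (Avoids121-erase p′ M q′ avoid′)
                          erased-content erased-≼ ne)
    where
    shorter : length (p ++ q) ℕ.< length w
    shorter = subst (length (p ++ q) ℕ.<_) (sym (length-insert-++ p M q)) (s≤s (ℕₚ.m≤n+m _ _))

increasing-ascent : (w : Word n) → StrictlyBelow⇒IncreasingAscent w
increasing-ascent {n} = WF.All.wfRec (On.wellFounded length <-wellFounded) _ StrictlyBelow⇒IncreasingAscent step
  where
  step : (w : Word n) → (∀ {w₀} → length w₀ ℕ.< length w → StrictlyBelow⇒IncreasingAscent w₀) →
         StrictlyBelow⇒IncreasingAscent w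
  step w ih {z} aw az w≈z w≼z w≢z
    with m , m∈w , minimal ← minimum-letter w (λ { refl → w≢z (sym (SameContent-[] w≈z)) })
    with p , k , q , refl , m∉p , m∉q ← minimum-run aw m∈w minimal
    with p′ , k′ , q′ , refl , m∉p′ , m∉q′ ←
           minimum-run az (∈-resp-SameContent w≈z m∈w) (minimal ∘ ∈-resp-SameContent (sym ∘ w≈z))
    with refl ← trans (sym (occ-run (suc k) m∉p m∉q)) (trans (w≈z m) (occ-run (suc k′) m∉p′ m∉q′)) =
    MinimalRun.step k m∉p m∉q m∉p′ m∉q′ minimal aw az w≈z w≼z ih w≢z

∉-after-ascent : {w : Word n} {a c : Fin n} (u v : Word n) → Avoids121 w →
                 w ≡ u ++ a ∷ c ∷ v → a < c → a ∉ c ∷ v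
∉-after-ascent u v avoid eq a<c (here refl)  = Finₚ.<-irrefl refl a<c
∉-after-ascent {a = a} {c} u v avoid eq a<c (there a∈v) =
  avoid (u ++ [ a ]) v (trans eq (sym (++-assoc u [ a ] (c ∷ v)))) a<c (∈-++⁺ʳ u (here refl)) a∈v

ascent-block : {w : Word n} {a c : Fin n} (u v : Word n) → Avoids121 w → w ≡ u ++ a ∷ c ∷ v → a < c →
               Σ[ u₁ ∈ Word n ] Σ[ B ∈ Word n ] IsBlockSplit a w u₁ B (c ∷ v)
ascent-block {a = a} {c} u v avoid w≡ a<c with a ∈? u
... | no a∉u = u , [ a ] , w≡ , a∉u , ∉-after-ascent u v avoid w≡ a<c , [] , refl , inj₁ refl
... | yes a∈u with u₁ , r , refl , a∉u₁ ← first-occurrence a∈u =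
  u₁ , a ∷ r ++ [ a ] , trans w≡ regroup , a∉u₁ , ∉-after-ascent _ v avoid w≡ a<c ,
  r ++ [ a ] , refl , inj₂ (r , refl)
  where
  regroup : (u₁ ++ a ∷ r) ++ a ∷ c ∷ v ≡ u₁ ++ (a ∷ r ++ [ a ]) ++ c ∷ v
  regroup = trans (++-assoc u₁ (a ∷ r) (a ∷ c ∷ v))
                  (cong (λ T → u₁ ++ a ∷ T) (sym (++-assoc r [ a ] (c ∷ v))))

module Transposition {n : ℕ} {w : Word n} {a c : Fin n} {u₁ B u₂ B′ : Word n}
  (avoid : Avoids121 w) (a<c : a < c)
  (w≡ : w ≡ u₁ ++ B ++ c ∷ u₂) (a∉u₁ : a ∉ u₁)
  (B≡ : B ≡ a ∷ B′) (B′-shape : B′ ≡ [] ⊎ Σ (Word n) λ B″ → B′ ≡ B″ ++ [ a ])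
  where

  t : Word n
  t = u₁ ++ c ∷ B ++ u₂

  a∈B : a ∈ B
  a∈B = subst (a ∈_) (sym B≡) (here refl)

  interior : ∀ {x} → x ∈ B → x ≢ a → ∃₂ λ b₁ b₂ → w ≡ u₁ ++ a ∷ b₁ ++ x ∷ b₂ ++ a ∷ c ∷ u₂
  interior {x} x∈B x≢a = from-shape B′-shape (subst (x ∈_) B≡ x∈B)
    where
    from-shape : B′ ≡ [] ⊎ Σ (Word n) (λ B″ → B′ ≡ B″ ++ [ a ]) → x ∈ a ∷ B′ →
                 ∃₂ λ b₁ b₂ → w ≡ u₁ ++ a ∷ b₁ ++ x ∷ b₂ ++ a ∷ c ∷ u₂
    from-shape _                (here x≡a) = contradiction x≡a x≢a
    from-shape (inj₁ refl)        (there ())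
    from-shape (inj₂ (B″ , refl)) (there x∈B″a) with ∈-++⁻ B″ x∈B″a
    ... | inj₂ (here x≡a) = contradiction x≡a x≢a
    ... | inj₁ x∈B″ with b₁ , b₂ , refl ← ∈-∃++ x∈B″ =
      b₁ , b₂ , trans w≡ (cong (u₁ ++_) (trans (cong (_++ c ∷ u₂) B≡) (cong (a ∷_)
                  (trans (++-assoc (b₁ ++ x ∷ b₂) [ a ] (c ∷ u₂)) (++-assoc b₁ (x ∷ b₂) (a ∷ c ∷ u₂))))))

  regroup : ∀ b₁ {x} b₂ →
            u₁ ++ a ∷ b₁ ++ x ∷ b₂ ++ a ∷ c ∷ u₂ ≡ (u₁ ++ a ∷ b₁ ++ x ∷ b₂) ++ a ∷ c ∷ u₂
  regroup b₁ {x} b₂ = sym (trans (++-assoc u₁ (a ∷ b₁ ++ x ∷ b₂) (a ∷ c ∷ u₂))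
                                  (cong (λ T → u₁ ++ a ∷ T) (++-assoc b₁ (x ∷ b₂) (a ∷ c ∷ u₂))))

  B-below : ∀ {x} → x ∈ B → x ≢ a → x < a
  B-below {x} x∈B x≢a with b₁ , b₂ , eq ← interior x∈B x≢a = Finₚ.≤∧≢⇒< (ℕₚ.≮⇒≥ a≮x) x≢a
    where
    a≮x : ¬ a < x
    a≮x a<x = avoid (u₁ ++ a ∷ b₁) (b₂ ++ a ∷ c ∷ u₂) (trans eq (sym (++-assoc u₁ (a ∷ b₁) _))) a<x
                (∈-++⁺ʳ u₁ (here refl)) (∈-++⁺ʳ b₂ (here refl))

  B-≤ : ∀ {x} → x ∈ B → x ≤ a
  B-≤ {x} x∈B with x ≟ a
  ... | yes refl = Finₚ.≤-refl
  ... | no x≢a  = ℕₚ.<⇒≤ (B-below x∈B x≢a)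

  c∉B : c ∉ B
  c∉B c∈B = ℕₚ.<⇒≱ a<c (B-≤ c∈B)

  B∉u₁ : ∀ {x} → x ∈ B → x ∉ u₁
  B∉u₁ {x} x∈B x∈u₁ with x ≟ a
  ... | yes refl = a∉u₁ x∈u₁
  ... | no x≢a with b₁ , b₂ , eq ← interior x∈B x≢a =
    avoid u₁ (b₁ ++ x ∷ b₂ ++ a ∷ c ∷ u₂) eq (B-below x∈B x≢a) x∈u₁ (∈-++⁺ʳ b₁ (here refl))

  B∉cu₂ : ∀ {x} → x ∈ B → x ≢ a → x ∉ c ∷ u₂
  B∉cu₂ x∈B x≢a (here refl) = ℕₚ.<-asym (B-below x∈B x≢a) a<c
  B∉cu₂ {x} x∈B x≢a (there x∈u₂) with b₁ , b₂ , eq ← interior x∈B x≢a =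
    avoid (u₁ ++ a ∷ b₁ ++ x ∷ b₂) (c ∷ u₂) (trans eq (regroup b₁ b₂)) (B-below x∈B x≢a)
      (∈-++⁺ʳ u₁ (there (∈-++⁺ʳ b₁ (here refl)))) (there x∈u₂)

  inv-B≡0 : ∀ {x} → x ∈ B → inv B c x ≡ 0
  inv-B≡0 {x} x∈B = ℕₚ.n≤0⇒n≡0 (subst (inv B c x ℕ.≤_) (occ-∉ B c∉B) (inv-≤-occ x c B))

  inv-w-c : ∀ {x} → x ∈ B → inv w c x ≡ occ c u₁
  inv-w-c {x} x∈B = begin
    inv w c x                         ≡⟨ cong (λ T → inv T c x) w≡ ⟩
    inv (u₁ ++ B ++ c ∷ u₂) c x       ≡⟨ inv-++-∉ u₁ _ (B∉u₁ x∈B) ⟩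
    occ c u₁ + inv (B ++ c ∷ u₂) c x  ≡⟨ cong (occ c u₁ +_) (trans (inv-++-∈ B _ x∈B) (inv-B≡0 x∈B)) ⟩
    occ c u₁ + 0                      ≡⟨ ℕₚ.+-identityʳ _ ⟩
    occ c u₁                          ∎
    where open ≡-Reasoning

  inv-w-a : ∀ {x} → x ∈ B → x ≢ a → 0 ℕ.< inv w a x
  inv-w-a {x} x∈B x≢a = subst (0 ℕ.<_) (sym eq) (ℕₚ.<-≤-trans (s≤s z≤n) (ℕₚ.m≤n+m _ (occ a u₁)))
    where
    eq : inv w a x ≡ occ a u₁ + suc (inv (B′ ++ c ∷ u₂) a x)
    eq = trans (cong (λ T → inv T a x) w≡) (trans (inv-++-∉ u₁ _ (B∉u₁ x∈B))
           (cong (occ a u₁ +_) (trans (cong (λ T → inv (T ++ c ∷ u₂) a x) B≡) (inv-∷-c _ (x≢a ∘ sym)))))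

  inv-t-∈ : ∀ {x} → x ∈ B → inv t c x ≡ suc (inv w c x)
  inv-t-∈ {x} x∈B = begin
    inv t c x                           ≡⟨ inv-++-∉ u₁ _ (B∉u₁ x∈B) ⟩
    occ c u₁ + inv (c ∷ B ++ u₂) c x    ≡⟨ cong (occ c u₁ +_) (inv-∷-c {a = x} (B ++ u₂) c≢x) ⟩
    occ c u₁ + suc (inv (B ++ u₂) c x)  ≡⟨ cong (λ k → occ c u₁ + suc k) inv-B≡0′ ⟩
    occ c u₁ + 1                        ≡⟨ ℕₚ.+-comm _ 1 ⟩
    suc (occ c u₁)                      ≡⟨ cong suc (inv-w-c x∈B) ⟨
    suc (inv w c x)                     ∎
    where
    open ≡-Reasoning
    c≢x : c ≢ x
    c≢x refl = c∉B x∈B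
    inv-B≡0′ : inv (B ++ u₂) c x ≡ 0
    inv-B≡0′ = trans (inv-++-∈ B u₂ x∈B) (inv-B≡0 x∈B)

  inv-t-∉ : ∀ {x y} → x < y → ¬ (y ≡ c × x ∈ B) → inv t y x ≡ inv w y x
  inv-t-∉ {x} {y} x<y not-c-B = trans (inv-++-congʳ u₁ swapped) (sym (cong (λ T → inv T y x) w≡))
    where
    swapped : inv (c ∷ B ++ u₂) y x ≡ inv (B ++ c ∷ u₂) y x
    swapped with x ∈? B | x ≟ c
    ... | yes x∈B | _ = trans (inv-∷-≢ {a = x} {y} {c} (B ++ u₂) (λ { refl → c∉B x∈B })
                                                                 (λ { refl → not-c-B (refl , x∈B) }))
                          (trans (inv-++-∈ B u₂ x∈B) (sym (inv-++-∈ B (c ∷ u₂) x∈B)))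
    ... | no x∉B | yes refl = trans (inv-∷-≡ c y _)
                                (sym (trans (inv-++-∉ B (c ∷ u₂) x∉B)
                                            (cong₂ _+_ (occ-∉ B y∉B) (inv-∷-≡ c y u₂))))
      where
      y∉B : y ∉ B
      y∉B y∈B = ℕₚ.<-asym a<c (ℕₚ.<-≤-trans x<y (B-≤ y∈B))
    ... | no x∉B | no x≢c = trans (inv-↭-prefix u₂ x∉cB (∷↭∷ʳ c B))
                                  (cong (λ T → inv T y x) (++-assoc B [ c ] u₂))
      where
      x∉cB : x ∉ c ∷ B
      x∉cB (here x≡c) = x≢c x≡c
      x∉cB (there x∈B) = x∉B x∈B

  t-content : SameContent t w
  t-content i = trans (occ-↭ i (++⁺ˡ u₁ (shifts [ c ] B))) (cong (occ i) (sym w≡))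

  t-avoids : Avoids121 t
  t-avoids {i} {j} U V eq i<j i∈U i∈V with ++∷-≡-++⁻ U V u₁ (c ∷ B ++ u₂) (sym eq)
  ... | inj₁ (r , refl , refl) =
    avoid U (r ++ B ++ c ∷ u₂) (trans w≡ (++-assoc U (j ∷ r) _)) i<j i∈U
      (∈-resp-↭ (++⁺ˡ r (shifts [ c ] B)) i∈V)
  ... | inj₂ ([] , refl , refl) with ∈-++⁻ B i∈V
  ...   | inj₁ i∈B  = B∉u₁ i∈B (subst (i ∈_) (++-identityʳ u₁) i∈U)
  ...   | inj₂ i∈u₂ = avoid (u₁ ++ B) u₂ (trans w≡ (sym (++-assoc u₁ B (c ∷ u₂)))) i<j
                        (∈-++⁺ˡ (subst (i ∈_) (++-identityʳ u₁) i∈U)) i∈u₂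
  t-avoids {i} {j} U V eq i<j i∈U i∈V | inj₂ (_ ∷ r , eq′ , refl)
    with refl , eq″ ← ∷-injective eq′ with ++∷-≡-++⁻ r V B u₂ (sym eq″)
  ... | inj₁ (r′ , refl , refl) =
    avoid (u₁ ++ r) (r′ ++ c ∷ u₂)
      (trans w≡ (trans (cong (u₁ ++_) (++-assoc r (j ∷ r′) (c ∷ u₂))) (sym (++-assoc u₁ r _)))) i<j
      (∈-++∷⁻ u₁ i∈U i≢c) (∈-insert-++ r′ [ c ] i∈V)
    where
    i≢c : i ≢ c
    i≢c refl = ℕₚ.<-asym a<c (ℕₚ.<-≤-trans i<j (B-≤ (∈-++⁺ʳ r (here refl))))
  ... | inj₂ (r′ , refl , refl) =
    avoid (u₁ ++ B ++ c ∷ r′) V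
      (trans w≡ (sym (trans (++-assoc u₁ (B ++ c ∷ r′) _) (cong (u₁ ++_) (++-assoc B (c ∷ r′) _))))) i<j
      (∈-resp-↭ (++⁺ˡ u₁ (shifts [ c ] B)) i∈U) i∈V

  w≼t : w ≼ t
  w≼t x y x<y with y ≟ c | x ∈? B
  ... | yes refl | yes x∈B = subst (inv w y x ℕ.≤_) (sym (inv-t-∈ x∈B)) (ℕₚ.n≤1+n _)
  ... | yes refl | no x∉B  = ℕₚ.≤-reflexive (sym (inv-t-∉ x<y (x∉B ∘ proj₂)))
  ... | no y≢c   | _       = ℕₚ.≤-reflexive (sym (inv-t-∉ x<y (y≢c ∘ proj₁)))

  t≢w : t ≢ w
  t≢w t≡w = ℕₚ.1+n≢n (trans (sym (inv-t-∈ a∈B)) (cong (λ T → inv T c a) t≡w))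

  t≼ : ∀ z → w ≼ z → inv w c a ℕ.< inv z c a → t ≼ z
  t≼ z w≼z grows x y x<y with y ≟ c | x ∈? B
  ... | yes refl | yes x∈B = begin
    inv t c x         ≡⟨ inv-t-∈ x∈B ⟩
    suc (inv w c x)   ≡⟨ cong suc (trans (inv-w-c x∈B) (sym (inv-w-c a∈B))) ⟩
    suc (inv w c a)   ≤⟨ grows ⟩
    inv z c a         ≤⟨ a-precedes ⟩
    inv z c x         ∎
    where
    open ℕₚ.≤-Reasoning
    a-precedes : inv z c a ℕ.≤ inv z c x
    a-precedes with x ≟ a
    ... | yes refl = ℕₚ.≤-refl
    ... | no x≢a  = inv-≤-of-preceding z (ℕₚ.<-≤-trans (inv-w-a x∈B x≢a) (w≼z x a (B-below x∈B x≢a)))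
                      (x≢a ∘ sym) (λ { refl → c∉B x∈B }) (Finₚ.<⇒≢ a<c ∘ sym)
  ... | yes refl | no x∉B = ℕₚ.≤-trans (ℕₚ.≤-reflexive (inv-t-∉ x<y (x∉B ∘ proj₂))) (w≼z x y x<y)
  ... | no y≢c   | _      = ℕₚ.≤-trans (ℕₚ.≤-reflexive (inv-t-∉ x<y (y≢c ∘ proj₁))) (w≼z x y x<y)

  ascent-into-c : ∀ {a′ u′ v′} → w ≡ u′ ++ a′ ∷ c ∷ v′ → a′ ∈ B → a′ ≡ a
  ascent-into-c {a′} {u′} {v′} eq a′∈B with a′ ≟ a
  ... | yes a′≡a = a′≡a
  ... | no a′≢a with b₁ , b₂ , eqB ← interior a′∈B a′≢a =
    contradiction a∈v′
      (avoid (u′ ++ [ a′ ]) v′ (trans eq (sym (++-assoc u′ [ a′ ] (c ∷ v′)))) a<c (∈-++⁺ˡ a∈u′))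
    where
    a∈u′ : a ∈ u′
    a∈u′ with ∷-positions u₁ _ u′ (c ∷ v′) (trans (sym eqB) eq) (a′≢a ∘ sym)
    ... | inj₁ (a∈u′ , _) = a∈u′
    ... | inj₂ (a′∈u₁ , _) = contradiction a′∈u₁ (B∉u₁ a′∈B)
    a∈v′ : a ∈ v′
    a∈v′ with ∷-positions (u₁ ++ a ∷ b₁ ++ a′ ∷ b₂) (c ∷ u₂) u′ (c ∷ v′)
                            (trans (sym (trans eqB (regroup b₁ b₂))) eq) (a′≢a ∘ sym)
    ... | inj₁ (_ , a′∈cu₂)        = contradiction a′∈cu₂ (B∉cu₂ a′∈B a′≢a)
    ... | inj₂ (_ , here a≡c)     = contradiction a≡c (Finₚ.<⇒≢ a<c)
    ... | inj₂ (_ , there a∈v′)  = a∈v′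

  below-t-unchanged : ∀ z {x y} → z ≼ t → x < y → ¬ (y ≡ c × x ∈ B) → inv z y x ℕ.≤ inv w y x
  below-t-unchanged z {x} {y} z≼t x<y not-c-B = subst (inv z y x ℕ.≤_) (inv-t-∉ x<y not-c-B) (z≼t x y x<y)

  t-stirling : ∀ {s : Fin n → ℕ} → (∀ i → occ i w ≡ s i) → IsStirling s t
  t-stirling w-count = (λ i → trans (t-content i) (w-count i)) , Avoids121⇒¬Contains121 t-avoids

  -- A Stirling permutation strictly between w and t gains inversions along some ascent of w,
  -- and the only candidate is (a , c).
  covers : ∀ {s : Fin n → ℕ} → (∀ i → occ i w ≡ s i) → Covers s w t
  covers {s} w-count = w≼t , t≢w ∘ sym , squeezed
    where
    squeezed : (z : Word n) → IsStirling s z → w ≼ z → z ≼ t → z ≢ w → z ≡ t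
    squeezed z (z-count , z-121) w≼z z≼t z≢w
      with a′ , c′ , (a′<c′ , u′ , v′ , w≡′) , grows
             ← increasing-ascent w avoid (¬Contains121⇒Avoids121 z-121) (same-counts w z w-count z-count)
                 w≼z (z≢w ∘ sym)
      with c′ ≟ c | a′ ∈? B
    ... | yes refl | yes a′∈B with refl ← ascent-into-c w≡′ a′∈B =
      ≼-antisym (¬Contains121⇒Avoids121 z-121) t-avoids (same-counts z t z-count (proj₁ (t-stirling w-count)))
        z≼t (t≼ z w≼z grows)
    ... | yes refl | no a′∉B =
      contradiction (below-t-unchanged z z≼t a′<c′ (a′∉B ∘ proj₂)) (ℕₚ.<⇒≱ grows)
    ... | no c′≢c  | _ =
      contradiction (below-t-unchanged z z≼t a′<c′ (c′≢c ∘ proj₁)) (ℕₚ.<⇒≱ grows)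

corollary2p2 : (n : ℕ) → (s : Fin n → ℕ) → IsComposition n s →
    (w w' : Word n) → IsStirling s w → IsStirling s w' →
    Covers s w w' ⇔ (Σ (Fin n) λ a → Σ (Fin n) λ c → IsAscent w a c × IsTransposition w a c w')
corollary2p2 n s _ w w′ (w-count , w-121) (w′-count , w′-121) = mk⇔ cover⇒transposition transposition⇒cover
  where
  avoid : Avoids121 w
  avoid = ¬Contains121⇒Avoids121 w-121

  cover⇒transposition : Covers s w w′ →
                        Σ[ a ∈ Fin n ] Σ[ c ∈ Fin n ] IsAscent w a c × IsTransposition w a c w′
  cover⇒transposition (w≼w′ , w≢w′ , squeezed)
    with a , c , ascent@(a<c , u , v , w≡) , grows ←
           increasing-ascent w avoid (¬Contains121⇒Avoids121 w′-121) (same-counts w w′ w-count w′-count) w≼w′ w≢w′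
    with u₁ , B , block@(w≡′ , a∉u₁ , _ , B′ , B≡ , B′-shape) ← ascent-block u v avoid w≡ a<c =
    a , c , ascent , u₁ , B , v , block , sym (squeezed t (t-stirling w-count) w≼t (t≼ w′ w≼w′ grows) t≢w)
    where open Transposition avoid a<c w≡′ a∉u₁ B≡ B′-shape

  transposition⇒cover : Σ[ a ∈ Fin n ] Σ[ c ∈ Fin n ] IsAscent w a c × IsTransposition w a c w′ →
                        Covers s w w′
  transposition⇒cover (a , c , (a<c , _) , u₁ , B , u₂ , (w≡ , a∉u₁ , _ , B′ , B≡ , B′-shape) , refl) =
    covers w-count
    where open Transposition avoid a<c w≡ a∉u₁ B≡ B′-shape
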